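{- Let $n$ be an odd positive integer and let $G$ be a balanced Gray code for $\mathcal{P}^{\mathrm{all}}_n$ starting at $12\cdots(n-1)n$ and ending at $12\cdots n(n-1)$, such that $(n-1,n)$ is the transposition closing the cycle. Then there exists an almost balanced Gray code for $\mathcal{P}^{\mathrm{all}}_{n+1}$ starting at $12\cdots(n+1)$ and ending at $23\cdots(n+1)1$.
   Context: $S_N$ is the set of permutations of $[N]$ in one-line notation; a transposition $(i,j)$ acts by interchanging the entries $i$ and $j$. $\mathcal{P}^{\mathrm{all}}_N$ is the graph on $S_N$ whose edges join permutations differing by a transposition. A Gray code for $\mathcal{P}^{\mathrm{all}}_N$ is a listing $\pi_1,\dots,\pi_{N!}$ of all of $S_N$ with $\pi_{i+1}$ obtained from $\pi_i$ by a transposition $t_i$; it is cyclic if $\pi_1$ is obtained from $\pi_{N!}$ by a transposition (the closing transposition), and a cyclic Gray code is balanced if, counting the closing transposition, each transposition occurs exactly $2(N-2)!$ times. A transposition $(i,j)$ is adjacent if $|i-j|=1$ and wide otherwise. A Gray code for $\mathcal{P}^{\mathrm{all}}_N$ is almost balanced if every wide transposition occurs exactly $2(N-2)!$ times among $t_1,\dots,t_{N!-1}$. -}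

module Defs where

open import Data.Nat using (ℕ; zero; suc; _*_; _∸_; _<_; _!)
open import Data.Fin as Fin using (Fin; toℕ; fromℕ; inject₁)
open import Data.Vec using (Vec; map; tabulate; _∷ʳ_)
open import Data.Vec.Properties using (≡-dec)
open import Data.List using (List; []; _∷_; _++_; take; length; filter)
open import Data.List.Relation.Unary.All using (All)
open import Data.List.Relation.Unary.Unique.Propositional using (Unique)
open import Data.List.Membership.Propositional using (_∈_)
open import Data.Product using (_×_; _,_; Σ; ∃; ∃-syntax)
open import Data.Bool using (if_then_else_)
open import Relation.Nullary using (does)
open import Relation.Binary.PropositionalEquality using (_≡_)

-- A word of length N over the alphabet [N] = {0,…,N-1} (0-based: value k stands for k+1),
-- in one-line notation.
Word : ℕ → Set
Word N = Vec (Fin N) N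

IsPerm : ∀ {N} → Word N → Set
IsPerm {N} w = ∀ (i j : Fin N) → Data.Vec.lookup w i ≡ Data.Vec.lookup w j → i ≡ j

swapVal : ∀ {N} → Fin N → Fin N → Fin N → Fin N
swapVal a b x = if does (x Fin.≟ a) then b else (if does (x Fin.≟ b) then a else x)

act : ∀ {N} → Fin N → Fin N → Word N → Word N
act a b w = map (swapVal a b) w

_≟w_ : ∀ {N} (v w : Word N) → Relation.Nullary.Dec (v ≡ w)
_≟w_ = ≡-dec Fin._≟_

steps : ∀ {A : Set} → List A → List (A × A)
steps []           = []
steps (x ∷ [])     = []
steps (x ∷ y ∷ xs) = (x , y) ∷ steps (y ∷ xs)

count : ∀ {N} → Fin N → Fin N → List (Word N) → ℕ
count a b L = length (filter (λ p → act a b (Data.Product.proj₁ p) ≟w Data.Product.proj₂ p) (steps L))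

cycCount : ∀ {N} → Fin N → Fin N → List (Word N) → ℕ
cycCount a b L = count a b (L ++ take 1 L)

IsGrayCode : (N : ℕ) → List (Word N) → Set
IsGrayCode N L =
  All IsPerm L × Unique L × (∀ (w : Word N) → IsPerm w → w ∈ L) ×
  All (λ p → ∃[ a ] ∃[ b ] (toℕ a < toℕ b × act a b (Data.Product.proj₁ p) ≡ Data.Product.proj₂ p))
      (steps L)

StartsAt : ∀ {N} → List (Word N) → Word N → Set
StartsAt L w = ∃[ rest ] (L ≡ w ∷ rest)

EndsAt : ∀ {N} → List (Word N) → Word N → Set
EndsAt L w = ∃[ ini ] (L ≡ ini ++ (w ∷ []))

ClosedBy : ∀ {N} → Fin N → Fin N → List (Word N) → Set
ClosedBy a b L = ∃[ first ] ∃[ lst ] (StartsAt L first × EndsAt L lst × act a b lst ≡ first)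

Balanced : (N : ℕ) → List (Word N) → Set
Balanced N L = ∀ (a b : Fin N) → toℕ a < toℕ b → cycCount a b L ≡ 2 * ((N ∸ 2) !)

AlmostBalanced : (N : ℕ) → List (Word N) → Set
AlmostBalanced N L = ∀ (a b : Fin N) → suc (toℕ a) < toℕ b → count a b L ≡ 2 * ((N ∸ 2) !)

idW : ∀ {N} → Word N
idW = tabulate (λ i → i)

rotW : ∀ {N} → Word (suc N)
rotW {N} = tabulate {n = N} Fin.suc ∷ʳ Fin.zero

-- for n = m+2: the values n-1 and n (0-based: m and m+1)
penult : ∀ {m} → Fin (suc (suc m))
penult {m} = inject₁ (fromℕ m)

ult : ∀ {m} → Fin (suc (suc m))
ult {m} = fromℕ (suc m)

-- Entries are 1-based here (the code is 0-based).  S_(n+1) splits into n+1 blocks according to the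
-- last entry v, each a copy of S_n with its values relabelled around v.  As n is odd, the blocks pair
-- up as (n+1, n), (n-1, n-2), ..., (2, 1); H runs through each pair along a conjugate of G, forwards
-- in the upper block and backwards in the lower one, and passes from block v to block v-1 by the
-- adjacent transposition (v-1 v).  A wide transposition (a b) never occurs in a block with v ∈ {a, b},
-- nor between blocks.  In any other block it is the relabelling of a transposition of S_n that is not
-- the closing one, and G uses such a transposition exactly 2(n-2)! times, provided the relabelled
-- closing transposition is not wide.  That is why the blocks with last entry at least 3 use the
-- conjugate closed by (1 2) and the bottom pair uses the one closed by (2 3).  Summing over the n-1
-- blocks avoiding a and b gives 2(n-2)!(n-1) = 2(n-1)!.

module Submission where

open import Defs
open import Data.Nat using (ℕ; suc; _%_)
open import Data.List using (List)
open import Data.Product using (_×_; ∃-syntax)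
open import Relation.Binary.PropositionalEquality using (_≡_)

open import Data.Bool using (true; false; if_then_else_)
open import Data.Empty using (⊥; ⊥-elim)
open import Data.Fin as Fin using (Fin; zero; suc; toℕ; fromℕ; fromℕ<; inject₁; punchIn; punchOut)
import Data.Fin.Properties as Finₚ
open import Data.List as List using ([]; _∷_; _++_; map; reverse; take; filter; length)
import Data.List.Properties as Listₚ
open import Data.List.Membership.Propositional using (_∈_)
import Data.List.Membership.Propositional.Properties as ∈ₚ
open import Data.List.Relation.Binary.Disjoint.Propositional using (Disjoint)
open import Data.List.Relation.Binary.Permutation.Propositional using (↭⇒↭ₛ; ↭-sym)
open import Data.List.Relation.Binary.Permutation.Propositional.Properties
  using (↭-reverse; ↭-length; filter-↭; All-resp-↭; ∈-resp-↭)
import Data.List.Relation.Binary.Permutation.Setoid.Properties as ↭ₛ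
open import Data.List.Relation.Unary.All as All using (All; _∷_)
import Data.List.Relation.Unary.All.Properties as Allₚ
open import Data.List.Relation.Unary.Unique.Propositional using (Unique)
import Data.List.Relation.Unary.Unique.Propositional.Properties as Uniqueₚ
open import Data.Nat as ℕ using (zero; _+_; _*_; _∸_; _<_; _≤_; _!; z≤n; s≤s)
import Data.Nat.Properties as ℕₚ
open import Data.Nat.Solver using (module +-*-Solver)
open import Data.Product as Product using (_,_; proj₁; proj₂; swap)
open import Data.Sum as Sum using (_⊎_; inj₁; inj₂)
open import Data.Vec as Vec using (Vec; lookup; tabulate)
import Data.Vec.Properties as Vecₚ
open import Function using (_∘_)
open import Level using (0ℓ)
open import Relation.Binary.Definitions using (tri<; tri≈; tri>)
open import Relation.Binary.PropositionalEquality
  using (_≢_; refl; sym; trans; cong; cong₂; subst; subst₂; setoid; module ≡-Reasoning)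
open import Relation.Nullary using (Dec; ¬_; ¬?; yes; no; does)
open import Relation.Nullary.Decidable using (_×-dec_)
open import Relation.Unary using (Pred; Decidable; _≐_)

module _ {n : ℕ} where

  data SwapValCase (a b x : Fin n) : Set where
    at-left  : x ≡ a → SwapValCase a b x
    at-right : x ≢ a → x ≡ b → SwapValCase a b x
    off      : x ≢ a → x ≢ b → SwapValCase a b x

  swapVal-case : ∀ (a b x : Fin n) → SwapValCase a b x
  swapVal-case a b x with x Fin.≟ a | x Fin.≟ b
  ... | yes x≡a | _       = at-left x≡a
  ... | no x≢a  | yes x≡b = at-right x≢a x≡b
  ... | no x≢a  | no x≢b  = off x≢a x≢b

  swapVal-left : ∀ (a b : Fin n) → swapVal a b a ≡ b
  swapVal-left a b with a Fin.≟ a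
  ... | yes _   = refl
  ... | no a≢a = ⊥-elim (a≢a refl)

  swapVal-right : ∀ (a b : Fin n) → swapVal a b b ≡ a
  swapVal-right a b with b Fin.≟ a | b Fin.≟ b
  ... | yes b≡a | _       = b≡a
  ... | no _    | yes _   = refl
  ... | no _    | no b≢b = ⊥-elim (b≢b refl)

  swapVal-off : ∀ (a b : Fin n) {x} → x ≢ a → x ≢ b → swapVal a b x ≡ x
  swapVal-off a b {x} x≢a x≢b with x Fin.≟ a | x Fin.≟ b
  ... | yes x≡a | _       = ⊥-elim (x≢a x≡a)
  ... | no _    | yes x≡b = ⊥-elim (x≢b x≡b)
  ... | no _    | no _    = refl

  swapVal-involutive : ∀ (a b x : Fin n) → swapVal a b (swapVal a b x) ≡ x
  swapVal-involutive a b x with swapVal-case a b x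
  ... | at-left refl    = trans (cong (swapVal a b) (swapVal-left a b)) (swapVal-right a b)
  ... | at-right _ refl = trans (cong (swapVal a b) (swapVal-right a x)) (swapVal-left a x)
  ... | off x≢a x≢b     = trans (cong (swapVal a b) (swapVal-off a b x≢a x≢b)) (swapVal-off a b x≢a x≢b)

  swapVal-injective : ∀ (a b : Fin n) {x y} → swapVal a b x ≡ swapVal a b y → x ≡ y
  swapVal-injective a b {x} {y} eq = begin
    x                               ≡⟨ swapVal-involutive a b x ⟨
    swapVal a b (swapVal a b x)     ≡⟨ cong (swapVal a b) eq ⟩
    swapVal a b (swapVal a b y)     ≡⟨ swapVal-involutive a b y ⟩
    y                               ∎
    where open ≡-Reasoning

  swapVal-comm : ∀ (a b x : Fin n) → swapVal a b x ≡ swapVal b a x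
  swapVal-comm a b x with swapVal-case a b x
  ... | at-left refl    = trans (swapVal-left x b) (sym (swapVal-right b x))
  ... | at-right _ refl = trans (swapVal-right a x) (sym (swapVal-left x a))
  ... | off x≢a x≢b     = trans (swapVal-off a b x≢a x≢b) (sym (swapVal-off b a x≢b x≢a))

  swapVal-moves : ∀ {a b v : Fin n} → a ≢ b → v ≡ a ⊎ v ≡ b → swapVal a b v ≢ v
  swapVal-moves {a} {b} a≢b (inj₁ refl) eq = a≢b (sym (trans (sym (swapVal-left a b)) eq))
  swapVal-moves {a} {b} a≢b (inj₂ refl) eq = a≢b (trans (sym (swapVal-right a b)) eq)

  SamePair : (a b c d : Fin n) → Set
  SamePair a b c d = (a ≡ c × b ≡ d) ⊎ (a ≡ d × b ≡ c)

  swapVal-unique : ∀ {a b c d : Fin n} → a ≢ b → (∀ x → swapVal a b x ≡ swapVal c d x) → SamePair a b c d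
  swapVal-unique {a} {b} {c} {d} a≢b same with swapVal-case c d a | trans (sym (swapVal-left a b)) (same a)
  ... | at-left refl    | b≡image = inj₁ (refl , trans b≡image (swapVal-left a d))
  ... | at-right _ refl | b≡image = inj₂ (refl , trans b≡image (swapVal-right c a))
  ... | off a≢c a≢d     | b≡image = ⊥-elim (a≢b (sym (trans b≡image (swapVal-off c d a≢c a≢d))))

swapVal-relabel : ∀ {n N} (s : Fin n → Fin N) → (∀ {x y} → s x ≡ s y → x ≡ y) →
                  ∀ a b x → s (swapVal a b x) ≡ swapVal (s a) (s b) (s x)
swapVal-relabel s s-inj a b x with swapVal-case a b x
... | at-left refl    = trans (cong s (swapVal-left a b)) (sym (swapVal-left (s a) (s b)))
... | at-right _ refl = trans (cong s (swapVal-right a b)) (sym (swapVal-right (s a) (s b)))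
... | off x≢a x≢b     = trans (cong s (swapVal-off a b x≢a x≢b))
                              (sym (swapVal-off (s a) (s b) (λ e → x≢a (s-inj e)) (λ e → x≢b (s-inj e))))

vec-ext : ∀ {A : Set} {k} {v w : Vec A k} → (∀ i → lookup v i ≡ lookup w i) → v ≡ w
vec-ext {v = v} {w} same = begin
  v                   ≡⟨ Vecₚ.tabulate∘lookup v ⟨
  tabulate (lookup v) ≡⟨ Vecₚ.tabulate-cong same ⟩
  tabulate (lookup w) ≡⟨ Vecₚ.tabulate∘lookup w ⟩
  w                   ∎
  where open ≡-Reasoning

module _ {N : ℕ} where

  lookup-act : ∀ (a b : Fin N) w i → lookup (act a b w) i ≡ swapVal a b (lookup w i)
  lookup-act a b w i = Vecₚ.lookup-map i (swapVal a b) w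

  lookup-idW : ∀ (i : Fin N) → lookup idW i ≡ i
  lookup-idW = Vecₚ.lookup∘tabulate (λ i → i)

  act-involutive : ∀ (a b : Fin N) w → act a b (act a b w) ≡ w
  act-involutive a b w = begin
    act a b (act a b w)                   ≡⟨ Vecₚ.map-∘ (swapVal a b) (swapVal a b) w ⟨
    Vec.map (swapVal a b ∘ swapVal a b) w ≡⟨ Vecₚ.map-cong (swapVal-involutive a b) w ⟩
    Vec.map (λ x → x) w                   ≡⟨ Vecₚ.map-id w ⟩
    w                                     ∎
    where open ≡-Reasoning

  act-comm : ∀ (a b : Fin N) w → act a b w ≡ act b a w
  act-comm a b = Vecₚ.map-cong (swapVal-comm a b)

  act-idW-injective : ∀ {a b c d : Fin N} → a ≢ b → act a b idW ≡ act c d idW → SamePair a b c d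
  act-idW-injective {a} {b} {c} {d} a≢b eq = swapVal-unique a≢b λ x → begin
    swapVal a b x              ≡⟨ cong (swapVal a b) (lookup-idW x) ⟨
    swapVal a b (lookup idW x) ≡⟨ lookup-act a b idW x ⟨
    lookup (act a b idW) x     ≡⟨ cong (λ w → lookup w x) eq ⟩
    lookup (act c d idW) x     ≡⟨ lookup-act c d idW x ⟩
    swapVal c d (lookup idW x) ≡⟨ cong (swapVal c d) (lookup-idW x) ⟩
    swapVal c d x              ∎
    where open ≡-Reasoning

-- Consecutive pairs and transposition counts

module _ {A : Set} where

  steps-join : ∀ (xs : List A) x y ys →
               steps ((xs List.∷ʳ x) ++ y ∷ ys) ≡ steps (xs List.∷ʳ x) ++ (x , y) ∷ steps (y ∷ ys)
  steps-join []            x y ys = refl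
  steps-join (z ∷ [])      x y ys = refl
  steps-join (z ∷ z′ ∷ zs) x y ys = cong ((z , z′) ∷_) (steps-join (z′ ∷ zs) x y ys)

  steps-map : ∀ {B : Set} (f : A → B) xs → steps (map f xs) ≡ map (Product.map f f) (steps xs)
  steps-map f []           = refl
  steps-map f (x ∷ [])     = refl
  steps-map f (x ∷ y ∷ xs) = cong ((f x , f y) ∷_) (steps-map f (y ∷ xs))

  steps-reverse : ∀ (xs : List A) → steps (reverse xs) ≡ map swap (reverse (steps xs))
  steps-reverse []           = refl
  steps-reverse (x ∷ [])     = refl
  steps-reverse (x ∷ y ∷ xs) = begin
    steps (reverse (x ∷ y ∷ xs))
      ≡⟨ cong steps (Listₚ.unfold-reverse x (y ∷ xs)) ⟩
    steps (reverse (y ∷ xs) List.∷ʳ x)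
      ≡⟨ cong (λ ys → steps (ys List.∷ʳ x)) (Listₚ.unfold-reverse y xs) ⟩
    steps ((reverse xs List.∷ʳ y) List.∷ʳ x)
      ≡⟨ steps-join (reverse xs) y x [] ⟩
    steps (reverse xs List.∷ʳ y) List.∷ʳ (y , x)
      ≡⟨ cong (λ ys → steps ys List.∷ʳ (y , x)) (Listₚ.unfold-reverse y xs) ⟨
    steps (reverse (y ∷ xs)) List.∷ʳ (y , x)
      ≡⟨ cong (List._∷ʳ (y , x)) (steps-reverse (y ∷ xs)) ⟩
    map swap (reverse (steps (y ∷ xs))) List.∷ʳ (y , x)
      ≡⟨ Listₚ.map-++ swap (reverse (steps (y ∷ xs))) ((x , y) ∷ []) ⟨
    map swap (reverse (steps (y ∷ xs)) List.∷ʳ (x , y))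
      ≡⟨ cong (map swap) (Listₚ.unfold-reverse (x , y) (steps (y ∷ xs))) ⟨
    map swap (reverse ((x , y) ∷ steps (y ∷ xs)))
      ∎
    where open ≡-Reasoning

  length-filter-≐ : ∀ {P Q : Pred A 0ℓ} (P? : Decidable P) (Q? : Decidable Q) → P ≐ Q →
                    ∀ xs → length (filter P? xs) ≡ length (filter Q? xs)
  length-filter-≐ P? Q? P≐Q xs = cong length (Listₚ.filter-≐ P? Q? P≐Q xs)

  length-filter-map : ∀ {B : Set} {P : Pred B 0ℓ} (P? : Decidable P) (f : A → B) xs →
                      length (filter P? (map f xs)) ≡ length (filter (P? ∘ f) xs)
  length-filter-map P? f []       = refl
  length-filter-map P? f (x ∷ xs) with does (P? (f x))
  ... | true  = cong suc (length-filter-map P? f xs)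
  ... | false = length-filter-map P? f xs

  length-filter-reverse : ∀ {P : Pred A 0ℓ} (P? : Decidable P) xs →
                          length (filter P? (reverse xs)) ≡ length (filter P? xs)
  length-filter-reverse P? xs = ↭-length (filter-↭ P? (↭-reverse xs))

module _ {N : ℕ} where

  Transposes : (a b : Fin N) → Pred (Word N × Word N) 0ℓ
  Transposes a b (x , y) = act a b x ≡ y

  transposes? : (a b : Fin N) → Decidable (Transposes a b)
  transposes? a b p = act a b (proj₁ p) ≟w proj₂ p

  count-++ : ∀ (a b : Fin N) {L₁ L₂ y y′} → EndsAt L₁ y → StartsAt L₂ y′ → act a b y ≢ y′ →
             count a b (L₁ ++ L₂) ≡ count a b L₁ + count a b L₂
  count-++ a b {y = y} {y′} (ini , refl) (rest , refl) ¬yy′ = begin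
    length (filter T? (steps ((ini List.∷ʳ y) ++ y′ ∷ rest)))
      ≡⟨ cong (length ∘ filter T?) (steps-join ini y y′ rest) ⟩
    length (filter T? (steps (ini List.∷ʳ y) ++ (y , y′) ∷ steps (y′ ∷ rest)))
      ≡⟨ cong length (Listₚ.filter-++ T? (steps (ini List.∷ʳ y)) _) ⟩
    length (filter T? (steps (ini List.∷ʳ y)) ++ filter T? ((y , y′) ∷ steps (y′ ∷ rest)))
      ≡⟨ Listₚ.length-++ (filter T? (steps (ini List.∷ʳ y))) ⟩
    count a b (ini List.∷ʳ y) + length (filter T? ((y , y′) ∷ steps (y′ ∷ rest)))
      ≡⟨ cong (λ l → count a b (ini List.∷ʳ y) + length l) (Listₚ.filter-reject T? ¬yy′) ⟩
    count a b (ini List.∷ʳ y) + count a b (y′ ∷ rest)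
      ∎
    where
    open ≡-Reasoning
    T? : Decidable (Transposes a b)
    T? = transposes? a b

  count-comm : ∀ (a b : Fin N) L → count a b L ≡ count b a L
  count-comm a b L = length-filter-≐ (transposes? a b) (transposes? b a) (ab⇒ba , ba⇒ab) (steps L)
    where
    ab⇒ba : ∀ {p} → Transposes a b p → Transposes b a p
    ab⇒ba {x , _} eq = trans (sym (act-comm a b x)) eq
    ba⇒ab : ∀ {p} → Transposes b a p → Transposes a b p
    ba⇒ab {x , _} eq = trans (act-comm a b x) eq

  count-reverse : ∀ (a b : Fin N) L → count a b (reverse L) ≡ count a b L
  count-reverse a b L = begin
    length (filter T? (steps (reverse L)))
      ≡⟨ cong (length ∘ filter T?) (steps-reverse L) ⟩
    length (filter T? (map swap (reverse (steps L))))
      ≡⟨ length-filter-map T? swap (reverse (steps L)) ⟩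
    length (filter (T? ∘ swap) (reverse (steps L)))
      ≡⟨ length-filter-reverse (T? ∘ swap) (steps L) ⟩
    length (filter (T? ∘ swap) (steps L))
      ≡⟨ length-filter-≐ (T? ∘ swap) T? (flip , flip) (steps L) ⟩
    count a b L
      ∎
    where
    open ≡-Reasoning
    T? : Decidable (Transposes a b)
    T? = transposes? a b
    flip : ∀ {x y} → act a b x ≡ y → act a b y ≡ x
    flip {x} refl = act-involutive a b x

module _ {n N : ℕ} (F : Word n → Word N) (a b : Fin N) where

  count-map-steps : ∀ L → count a b (map F L) ≡ length (filter (transposes? a b ∘ Product.map F F) (steps L))
  count-map-steps L = begin
    length (filter (transposes? a b) (steps (map F L)))
      ≡⟨ cong (length ∘ filter (transposes? a b)) (steps-map F L) ⟩
    length (filter (transposes? a b) (map (Product.map F F) (steps L)))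
      ≡⟨ length-filter-map (transposes? a b) (Product.map F F) (steps L) ⟩
    length (filter (transposes? a b ∘ Product.map F F) (steps L))
      ∎
    where open ≡-Reasoning

  count-map-≡0 : (∀ x y → act a b (F x) ≢ F y) → ∀ L → count a b (map F L) ≡ 0
  count-map-≡0 never L = trans (count-map-steps L)
    (cong length (Listₚ.filter-none _ (All.universal (λ p → never (proj₁ p) (proj₂ p)) (steps L))))

module _ {A : Set} {xs : List A} where

  All-reverse : ∀ {P : Pred A 0ℓ} → All P xs → All P (reverse xs)
  All-reverse = All-resp-↭ (↭-sym (↭-reverse xs))

  ∈-reverse : ∀ {x} → x ∈ xs → x ∈ reverse xs
  ∈-reverse = ∈-resp-↭ (↭-sym (↭-reverse xs))

  Unique-reverse : Unique xs → Unique (reverse xs)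
  Unique-reverse = ↭ₛ.Unique-resp-↭ (setoid A) (↭⇒↭ₛ (↭-sym (↭-reverse xs)))

disjoint-by : ∀ {A : Set} {P Q : Pred A 0ℓ} {xs ys} → All P xs → All Q ys → (∀ {w} → P w → Q w → ⊥) →
              Disjoint xs ys
disjoint-by Pxs Qys P∩Q=∅ (w∈xs , w∈ys) = P∩Q=∅ (All.lookup Pxs w∈xs) (All.lookup Qys w∈ys)

module _ {N : ℕ} where

  TranspositionStep : Word N × Word N → Set
  TranspositionStep (x , y) = ∃[ a ] ∃[ b ] (toℕ a < toℕ b × act a b x ≡ y)

  transpositionStep : ∀ {a b : Fin N} {x y} → a ≢ b → act a b x ≡ y → TranspositionStep (x , y)
  transpositionStep {a} {b} {x} a≢b eq with Finₚ.<-cmp a b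
  ... | tri< a<b _ _ = a , b , a<b , eq
  ... | tri≈ _ a≡b _ = ⊥-elim (a≢b a≡b)
  ... | tri> _ _ b<a = b , a , b<a , trans (act-comm b a x) eq

  TranspositionStep-sym : ∀ {x y} → TranspositionStep (x , y) → TranspositionStep (y , x)
  TranspositionStep-sym {x} (a , b , a<b , refl) = a , b , a<b , act-involutive a b x

  record IsGrayPath (L : List (Word N)) (x y : Word N) : Set where
    field
      perms  : All IsPerm L
      unique : Unique L
      moves  : All TranspositionStep (steps L)
      starts : StartsAt L x
      ends   : EndsAt L y

  open IsGrayPath

  IsGrayPath-reverse : ∀ {L x y} → IsGrayPath L x y → IsGrayPath (reverse L) y x
  IsGrayPath-reverse {L} {x} {y} P = record
    { perms  = All-reverse (perms P)
    ; unique = Unique-reverse (unique P)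
    ; moves  = subst (All TranspositionStep) (sym (steps-reverse L))
                 (Allₚ.map⁺ (All-reverse (All.map TranspositionStep-sym (moves P))))
    ; starts = let ini , L≡ini∷ʳy = ends P in
               reverse ini , trans (cong reverse L≡ini∷ʳy) (Listₚ.reverse-++ ini (y ∷ []))
    ; ends   = let rest , L≡x∷rest = starts P in
               reverse rest , trans (cong reverse L≡x∷rest) (Listₚ.unfold-reverse x rest)
    }

  IsGrayPath-++ : ∀ {L₁ L₂ x y y′ z} → IsGrayPath L₁ x y → IsGrayPath L₂ y′ z →
                  TranspositionStep (y , y′) → Disjoint L₁ L₂ → IsGrayPath (L₁ ++ L₂) x z
  IsGrayPath-++ {L₁} {L₂} {z = z} P Q y→y′ disjoint = record
    { perms  = Allₚ.++⁺ (perms P) (perms Q)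
    ; unique = Uniqueₚ.++⁺ (unique P) (unique Q) disjoint
    ; moves  = moves-++ (ends P) (starts Q)
    ; starts = let rest , eq = starts P in rest ++ L₂ , cong (_++ L₂) eq
    ; ends   = let ini , eq = ends Q in
               L₁ ++ ini , trans (cong (L₁ ++_) eq) (sym (Listₚ.++-assoc L₁ ini (z ∷ [])))
    }
    where
    moves-++ : EndsAt L₁ _ → StartsAt L₂ _ → All TranspositionStep (steps (L₁ ++ L₂))
    moves-++ (ini , refl) (rest , refl) = subst (All TranspositionStep) (sym (steps-join ini _ _ rest))
                                            (Allₚ.++⁺ (moves P) (y→y′ ∷ moves Q))

-- Relabellings and conjugation

record Relabelling (n N : ℕ) : Set where
  field
    value           : Fin n → Fin N
    word            : Word n → Word N
    value-injective : ∀ {x y} → value x ≡ value y → x ≡ y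
    word-injective  : ∀ {v w} → word v ≡ word w → v ≡ w
    IsPerm-word     : ∀ w → IsPerm w → IsPerm (word w)
    word-act        : ∀ a b w → word (act a b w) ≡ act (value a) (value b) (word w)

  TranspositionStep-word : ∀ {x y} → TranspositionStep (x , y) → TranspositionStep (word x , word y)
  TranspositionStep-word {x} (a , b , a<b , refl) =
    transpositionStep (λ eq → ℕₚ.<-irrefl (cong toℕ (value-injective eq)) a<b) (sym (word-act a b x))

  IsGrayPath-map : ∀ {L x y} → IsGrayPath L x y → IsGrayPath (map word L) (word x) (word y)
  IsGrayPath-map {L} {x} {y} P = record
    { perms  = Allₚ.map⁺ (All.map (λ {w} → IsPerm-word w) (perms P))
    ; unique = Uniqueₚ.map⁺ word-injective (unique P)
    ; moves  = subst (All TranspositionStep) (sym (steps-map word L))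
                 (Allₚ.map⁺ (All.map TranspositionStep-word (moves P)))
    ; starts = let rest , eq = starts P in map word rest , cong (map word) eq
    ; ends   = let ini , eq = ends P in
               map word ini , trans (cong (map word) eq) (Listₚ.map-++ word ini (y ∷ []))
    }
    where open IsGrayPath

  count-map : ∀ a b L → count (value a) (value b) (map word L) ≡ count a b L
  count-map a b L = trans (count-map-steps word (value a) (value b) L)
    (length-filter-≐ _ (transposes? a b) (reflect , preserve) (steps L))
    where
    reflect : ∀ {p} → Transposes (value a) (value b) (Product.map word word p) → Transposes a b p
    reflect {x , y} eq = word-injective (trans (word-act a b x) eq)
    preserve : ∀ {p} → Transposes a b p → Transposes (value a) (value b) (Product.map word word p)
    preserve {x , y} refl = sym (word-act a b x)

module Conjugation {n : ℕ} (p q : Fin n) where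

  σ : Fin n → Fin n
  σ = swapVal p q

  conj : Word n → Word n
  conj w = tabulate (σ ∘ lookup w ∘ σ)

  lookup-conj : ∀ w i → lookup (conj w) i ≡ σ (lookup w (σ i))
  lookup-conj w = Vecₚ.lookup∘tabulate (σ ∘ lookup w ∘ σ)

  conj-idW : conj idW ≡ idW
  conj-idW = vec-ext λ i → begin
    lookup (conj idW) i     ≡⟨ lookup-conj idW i ⟩
    σ (lookup idW (σ i))    ≡⟨ cong σ (lookup-idW (σ i)) ⟩
    σ (σ i)                 ≡⟨ swapVal-involutive p q i ⟩
    i                       ≡⟨ lookup-idW i ⟨
    lookup idW i            ∎
    where open ≡-Reasoning

  conj-involutive : ∀ w → conj (conj w) ≡ w
  conj-involutive w = vec-ext λ i → begin
    lookup (conj (conj w)) i       ≡⟨ lookup-conj (conj w) i ⟩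
    σ (lookup (conj w) (σ i))      ≡⟨ cong σ (lookup-conj w (σ i)) ⟩
    σ (σ (lookup w (σ (σ i))))     ≡⟨ swapVal-involutive p q _ ⟩
    lookup w (σ (σ i))             ≡⟨ cong (lookup w) (swapVal-involutive p q i) ⟩
    lookup w i                     ∎
    where open ≡-Reasoning

  conj-injective : ∀ {v w} → conj v ≡ conj w → v ≡ w
  conj-injective {v} {w} eq = trans (sym (conj-involutive v)) (trans (cong conj eq) (conj-involutive w))

  conj-act : ∀ a b w → conj (act a b w) ≡ act (σ a) (σ b) (conj w)
  conj-act a b w = vec-ext λ i → begin
    lookup (conj (act a b w)) i               ≡⟨ lookup-conj (act a b w) i ⟩
    σ (lookup (act a b w) (σ i))              ≡⟨ cong σ (lookup-act a b w (σ i)) ⟩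
    σ (swapVal a b (lookup w (σ i)))          ≡⟨ swapVal-relabel σ (swapVal-injective p q) a b (lookup w (σ i)) ⟩
    swapVal (σ a) (σ b) (σ (lookup w (σ i)))  ≡⟨ cong (swapVal (σ a) (σ b)) (lookup-conj w i) ⟨
    swapVal (σ a) (σ b) (lookup (conj w) i)   ≡⟨ lookup-act (σ a) (σ b) (conj w) i ⟨
    lookup (act (σ a) (σ b) (conj w)) i       ∎
    where open ≡-Reasoning

  IsPerm-conj : ∀ w → IsPerm w → IsPerm (conj w)
  IsPerm-conj w w-perm i j eq = swapVal-injective p q (w-perm (σ i) (σ j) (swapVal-injective p q (begin
    σ (lookup w (σ i)) ≡⟨ lookup-conj w i ⟨
    lookup (conj w) i  ≡⟨ eq ⟩
    lookup (conj w) j  ≡⟨ lookup-conj w j ⟩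
    σ (lookup w (σ j)) ∎)))
    where open ≡-Reasoning

  conjugation : Relabelling n n
  conjugation = record
    { value           = σ
    ; word            = conj
    ; value-injective = swapVal-injective p q
    ; word-injective  = conj-injective
    ; IsPerm-word     = IsPerm-conj
    ; word-act        = conj-act
    }

record BalancedCode {n : ℕ} (K : ℕ) (c d : Fin n) (L : List (Word n)) : Set where
  field
    path     : IsGrayPath L idW (act c d idW)
    complete : ∀ w → IsPerm w → w ∈ L
    balanced : ∀ a b → a ≢ b → cycCount a b L ≡ K

  open IsGrayPath path

  count-off-closing : ∀ a b → a ≢ b → ¬ SamePair a b c d → count a b L ≡ K
  count-off-closing a b a≢b not-closing = trans (sym count≡cycCount) (balanced a b a≢b)
    where
    closing-only : act a b (act c d idW) ≢ idW
    closing-only eq = not-closing (act-idW-injective a≢b (begin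
      act a b idW                     ≡⟨ cong (act a b) eq ⟨
      act a b (act a b (act c d idW)) ≡⟨ act-involutive a b (act c d idW) ⟩
      act c d idW                     ∎))
      where open ≡-Reasoning
    count≡cycCount : cycCount a b L ≡ count a b L
    count≡cycCount with starts
    ... | rest , refl = trans (count-++ a b ends ([] , refl) closing-only) (ℕₚ.+-identityʳ _)

balancedCode : ∀ {n} {c d : Fin n} {L} → IsGrayCode n L → Balanced n L →
               StartsAt L idW → EndsAt L (act c d idW) → BalancedCode (2 * ((n ∸ 2) !)) c d L
balancedCode {n} {L = L} (perms , unique , complete , moves) bal starts ends = record
  { path     = record { perms = perms ; unique = unique ; moves = moves ; starts = starts ; ends = ends }
  ; complete = complete
  ; balanced = balanced′
  }
  where
  balanced′ : ∀ a b → a ≢ b → cycCount a b L ≡ 2 * ((n ∸ 2) !)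
  balanced′ a b a≢b with Finₚ.<-cmp a b
  ... | tri< a<b _ _ = bal a b a<b
  ... | tri≈ _ a≡b _ = ⊥-elim (a≢b a≡b)
  ... | tri> _ _ b<a = trans (count-comm a b (L ++ take 1 L)) (bal b a b<a)

conjugate-code : ∀ {n K} (p q : Fin n) {c d c′ d′ L} → BalancedCode K c d L →
                 swapVal p q c ≡ c′ → swapVal p q d ≡ d′ →
                 BalancedCode K c′ d′ (map (Conjugation.conj p q) L)
conjugate-code {K = K} p q {c} {d} {L = L} C refl refl = record
  { path     = subst₂ (IsGrayPath (map conj L)) conj-idW conj-closing (IsGrayPath-map path)
  ; complete = λ w w-perm → subst (_∈ map conj L) (conj-involutive w)
                              (∈ₚ.∈-map⁺ conj (complete (conj w) (IsPerm-conj w w-perm)))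
  ; balanced = balanced′
  }
  where
  open BalancedCode C
  open Conjugation p q
  open Relabelling conjugation using (IsGrayPath-map; count-map)

  conj-closing : conj (act c d idW) ≡ act (σ c) (σ d) idW
  conj-closing = trans (conj-act c d idW) (cong (act (σ c) (σ d)) conj-idW)

  balanced′ : ∀ a b → a ≢ b → cycCount a b (map conj L) ≡ K
  balanced′ a b a≢b = begin
    count a b (map conj L ++ take 1 (map conj L))
      ≡⟨ cong (λ l → count a b (map conj L ++ l)) (Listₚ.take-map 1 L) ⟩
    count a b (map conj L ++ map conj (take 1 L))
      ≡⟨ cong (count a b) (Listₚ.map-++ conj L (take 1 L)) ⟨
    count a b (map conj (L ++ take 1 L))
      ≡⟨ cong₂ (λ a′ b′ → count a′ b′ (map conj (L ++ take 1 L)))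
               (swapVal-involutive p q a) (swapVal-involutive p q b) ⟨
    count (σ (σ a)) (σ (σ b)) (map conj (L ++ take 1 L))
      ≡⟨ count-map (σ a) (σ b) (L ++ take 1 L) ⟩
    cycCount (σ a) (σ b) L
      ≡⟨ balanced (σ a) (σ b) (a≢b ∘ swapVal-injective p q) ⟩
    K ∎
    where open ≡-Reasoning

-- Embedding S_n as the block of S_(n+1) with a given last entry

lookup-∷ʳ-inject₁ : ∀ {A : Set} {k} (xs : Vec A k) x i → lookup (xs Vec.∷ʳ x) (inject₁ i) ≡ lookup xs i
lookup-∷ʳ-inject₁ (y Vec.∷ xs) x zero    = refl
lookup-∷ʳ-inject₁ (y Vec.∷ xs) x (suc i) = lookup-∷ʳ-inject₁ xs x i

lookup-∷ʳ-fromℕ : ∀ {A : Set} {k} (xs : Vec A k) x → lookup (xs Vec.∷ʳ x) (fromℕ k) ≡ x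
lookup-∷ʳ-fromℕ Vec.[]       x = refl
lookup-∷ʳ-fromℕ (y Vec.∷ xs) x = lookup-∷ʳ-fromℕ xs x

data LastOrInject₁ {k : ℕ} : Fin (suc k) → Set where
  is-last    : LastOrInject₁ (fromℕ k)
  is-inject₁ : ∀ i → LastOrInject₁ (inject₁ i)

lastOrInject₁ : ∀ {k} (i : Fin (suc k)) → LastOrInject₁ i
lastOrInject₁ {zero}  zero    = is-last
lastOrInject₁ {suc k} zero    = is-inject₁ zero
lastOrInject₁ {suc k} (suc i) with lastOrInject₁ i
... | is-last      = is-last
... | is-inject₁ j = is-inject₁ (suc j)

swapVal-punchIn-adjacent : ∀ {k} (u i : Fin k) →
                           swapVal (inject₁ u) (suc u) (punchIn (suc u) i) ≡ punchIn (inject₁ u) i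
swapVal-punchIn-adjacent zero    zero    = swapVal-left zero (suc zero)
swapVal-punchIn-adjacent zero    (suc i) = swapVal-off zero (suc zero) (λ ()) (λ ())
swapVal-punchIn-adjacent (suc u) zero    = swapVal-off (suc (inject₁ u)) (suc (suc u)) (λ ()) (λ ())
swapVal-punchIn-adjacent (suc u) (suc i) = begin
  swapVal (suc (inject₁ u)) (suc (suc u)) (suc (punchIn (suc u) i))
    ≡⟨ swapVal-relabel suc Finₚ.suc-injective (inject₁ u) (suc u) (punchIn (suc u) i) ⟨
  suc (swapVal (inject₁ u) (suc u) (punchIn (suc u) i))
    ≡⟨ cong suc (swapVal-punchIn-adjacent u i) ⟩
  suc (punchIn (inject₁ u) i)
    ∎
  where open ≡-Reasoning

module _ {n : ℕ} where

  embed : Fin (suc n) → Word n → Word (suc n)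
  embed v π = Vec.map (punchIn v) π Vec.∷ʳ v

  lastEntry : Word (suc n) → Fin (suc n)
  lastEntry w = lookup w (fromℕ n)

  lastEntry-embed : ∀ v π → lastEntry (embed v π) ≡ v
  lastEntry-embed v π = lookup-∷ʳ-fromℕ (Vec.map (punchIn v) π) v

  lookup-embed-inject₁ : ∀ v π i → lookup (embed v π) (inject₁ i) ≡ punchIn v (lookup π i)
  lookup-embed-inject₁ v π i =
    trans (lookup-∷ʳ-inject₁ (Vec.map (punchIn v) π) v i) (Vecₚ.lookup-map i (punchIn v) π)

  act-embed : ∀ a b v π → act a b (embed v π) ≡ Vec.map (swapVal a b ∘ punchIn v) π Vec.∷ʳ swapVal a b v
  act-embed a b v π = trans (Vecₚ.map-∷ʳ (swapVal a b) v (Vec.map (punchIn v) π))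
                            (cong (Vec._∷ʳ swapVal a b v) (sym (Vecₚ.map-∘ (swapVal a b) (punchIn v) π)))

  act-embed-lastEntry : ∀ {a b v v′ π π′} → act a b (embed v π) ≡ embed v′ π′ → swapVal a b v ≡ v′
  act-embed-lastEntry {a} {b} {v} {π = π} eq = Vecₚ.∷ʳ-injectiveʳ _ _ (trans (sym (act-embed a b v π)) eq)

  embed-act : ∀ v a b π → embed v (act a b π) ≡ act (punchIn v a) (punchIn v b) (embed v π)
  embed-act v a b π = sym (begin
    act (punchIn v a) (punchIn v b) (embed v π)
      ≡⟨ act-embed (punchIn v a) (punchIn v b) v π ⟩
    Vec.map (swapVal (punchIn v a) (punchIn v b) ∘ punchIn v) π Vec.∷ʳ swapVal (punchIn v a) (punchIn v b) v
      ≡⟨ cong₂ Vec._∷ʳ_ (Vecₚ.map-cong relabel π)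
               (swapVal-off (punchIn v a) (punchIn v b)
                            (Finₚ.punchInᵢ≢i v a ∘ sym) (Finₚ.punchInᵢ≢i v b ∘ sym)) ⟩
    Vec.map (punchIn v ∘ swapVal a b) π Vec.∷ʳ v
      ≡⟨ cong (Vec._∷ʳ v) (Vecₚ.map-∘ (punchIn v) (swapVal a b) π) ⟩
    embed v (act a b π)
      ∎)
    where
    open ≡-Reasoning
    relabel : ∀ x → swapVal (punchIn v a) (punchIn v b) (punchIn v x) ≡ punchIn v (swapVal a b x)
    relabel x = sym (swapVal-relabel (punchIn v) (Finₚ.punchIn-injective v _ _) a b x)

  embed-step-down : ∀ {hi lo : Fin (suc n)} π → toℕ hi ≡ suc (toℕ lo) →
                    act lo hi (embed hi π) ≡ embed lo π
  embed-step-down {suc u} {lo} π hi≡1+lo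
    with Finₚ.toℕ-injective {i = lo} {j = inject₁ u}
           (trans (ℕₚ.suc-injective (sym hi≡1+lo)) (sym (Finₚ.toℕ-inject₁ u)))
  ... | refl = trans (act-embed (inject₁ u) (suc u) (suc u) π)
                     (cong₂ Vec._∷ʳ_ (Vecₚ.map-cong (swapVal-punchIn-adjacent u) π)
                                     (swapVal-right (inject₁ u) (suc u)))

  embed-injective : ∀ {v π π′} → embed v π ≡ embed v π′ → π ≡ π′
  embed-injective {v} {π} {π′} eq = vec-ext λ i → Finₚ.punchIn-injective v _ _ (begin
    punchIn v (lookup π i)          ≡⟨ lookup-embed-inject₁ v π i ⟨
    lookup (embed v π) (inject₁ i)  ≡⟨ cong (λ w → lookup w (inject₁ i)) eq ⟩
    lookup (embed v π′) (inject₁ i) ≡⟨ lookup-embed-inject₁ v π′ i ⟩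
    punchIn v (lookup π′ i)         ∎)
    where open ≡-Reasoning

  IsPerm-embed : ∀ v π → IsPerm π → IsPerm (embed v π)
  IsPerm-embed v π π-perm i j eq with lastOrInject₁ i | lastOrInject₁ j
  ... | is-last      | is-last      = refl
  ... | is-last      | is-inject₁ j = ⊥-elim (Finₚ.punchInᵢ≢i v (lookup π j)
          (trans (sym (lookup-embed-inject₁ v π j)) (trans (sym eq) (lastEntry-embed v π))))
  ... | is-inject₁ i | is-last      = ⊥-elim (Finₚ.punchInᵢ≢i v (lookup π i)
          (trans (sym (lookup-embed-inject₁ v π i)) (trans eq (lastEntry-embed v π))))
  ... | is-inject₁ i | is-inject₁ j = cong inject₁ (π-perm i j (Finₚ.punchIn-injective v _ _
          (trans (sym (lookup-embed-inject₁ v π i)) (trans eq (lookup-embed-inject₁ v π j)))))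

  embedding : Fin (suc n) → Relabelling n (suc n)
  embedding v = record
    { value           = punchIn v
    ; word            = embed v
    ; value-injective = Finₚ.punchIn-injective v _ _
    ; word-injective  = embed-injective
    ; IsPerm-word     = IsPerm-embed v
    ; word-act        = embed-act v
    }

  embed-complete : ∀ w → IsPerm w → ∃[ π ] (IsPerm π × embed (lastEntry w) π ≡ w)
  embed-complete w w-perm = π , π-perm , vec-ext same
    where
    v : Fin (suc n)
    v = lastEntry w
    v≢ : ∀ i → v ≢ lookup w (inject₁ i)
    v≢ i eq = Finₚ.fromℕ≢inject₁ (w-perm _ _ eq)
    π : Word n
    π = tabulate (λ i → punchOut (v≢ i))
    lookup-π : ∀ i → lookup π i ≡ punchOut (v≢ i)
    lookup-π = Vecₚ.lookup∘tabulate _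
    π-perm : IsPerm π
    π-perm i j eq = Finₚ.inject₁-injective (w-perm _ _ (Finₚ.punchOut-injective (v≢ i) (v≢ j)
                      (trans (sym (lookup-π i)) (trans eq (lookup-π j)))))
    same : ∀ i → lookup (embed v π) i ≡ lookup w i
    same i with lastOrInject₁ i
    ... | is-last      = lastEntry-embed v π
    ... | is-inject₁ j = begin
      lookup (embed v π) (inject₁ j) ≡⟨ lookup-embed-inject₁ v π j ⟩
      punchIn v (lookup π j)         ≡⟨ cong (punchIn v) (lookup-π j) ⟩
      punchIn v (punchOut (v≢ j))    ≡⟨ Finₚ.punchIn-punchOut (v≢ j) ⟩
      lookup w (inject₁ j)           ∎
      where open ≡-Reasoning

punchIn-fromℕ : ∀ {k} (i : Fin (suc k)) → punchIn (fromℕ (suc k)) i ≡ inject₁ i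
punchIn-fromℕ {k}     zero    = refl
punchIn-fromℕ {suc k} (suc i) = cong suc (punchIn-fromℕ i)

embed-fromℕ-idW : ∀ {n} → embed (fromℕ n) idW ≡ idW
embed-fromℕ-idW {zero}  = refl
embed-fromℕ-idW {suc n} = vec-ext λ i → trans (same i) (sym (lookup-idW i))
  where
  same : ∀ i → lookup (embed (fromℕ (suc n)) idW) i ≡ i
  same i with lastOrInject₁ i
  ... | is-last      = lastEntry-embed (fromℕ (suc n)) idW
  ... | is-inject₁ j = trans (lookup-embed-inject₁ _ idW j)
                             (trans (cong (punchIn (fromℕ (suc n))) (lookup-idW j)) (punchIn-fromℕ j))

embed-zero-idW : ∀ {n} → embed zero (idW {n}) ≡ rotW
embed-zero-idW = cong (Vec._∷ʳ zero) (sym (Vecₚ.tabulate-∘ suc (λ i → i)))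

-- Counting the values that avoid two given ones

indicator : ∀ {P : Set} → Dec P → ℕ
indicator P? = if does P? then 1 else 0

indicator-yes : ∀ {P : Set} (P? : Dec P) → P → indicator P? ≡ 1
indicator-yes (yes _)  _ = refl
indicator-yes (no ¬p) p = ⊥-elim (¬p p)

indicator-no : ∀ {P : Set} (P? : Dec P) → ¬ P → indicator P? ≡ 0
indicator-no (yes p) ¬p = ⊥-elim (¬p p)
indicator-no (no _)  _  = refl

≡*indicator : ∀ {P : Set} (P? : Dec P) {x} K → (P → x ≡ K) → (¬ P → x ≡ 0) → x ≡ K * indicator P?
≡*indicator (yes p) K if-p _    = trans (if-p p) (sym (ℕₚ.*-identityʳ K))
≡*indicator (no ¬p) K _ if-¬p = trans (if-¬p ¬p) (sym (ℕₚ.*-zeroʳ K))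

indicator-exclusive : ∀ {P Q : Set} (P? : Dec P) (Q? : Dec Q) → ¬ (P × Q) →
                      indicator (¬? P? ×-dec ¬? Q?) + (indicator P? + indicator Q?) ≡ 1
indicator-exclusive (yes p) (yes q) ¬p×q = ⊥-elim (¬p×q (p , q))
indicator-exclusive (yes _) (no _)  _    = refl
indicator-exclusive (no _)  (yes _) _    = refl
indicator-exclusive (no _)  (no _)  _    = refl

module _ (A B : ℕ) where

  avoids? : ∀ v → Dec (v ≢ A × v ≢ B)
  avoids? v = ¬? (v ℕ.≟ A) ×-dec ¬? (v ℕ.≟ B)

  avoiding : ℕ → ℕ
  avoiding zero    = 0
  avoiding (suc M) = indicator (avoids? M) + avoiding M

¬avoids⇒hits : ∀ {A B v} → ¬ (v ≢ A × v ≢ B) → v ≡ A ⊎ v ≡ B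
¬avoids⇒hits {A} {B} {v} ¬avoids with v ℕ.≟ A | v ℕ.≟ B
... | yes v≡A | _       = inj₁ v≡A
... | no _    | yes v≡B = inj₂ v≡B
... | no v≢A  | no v≢B  = ⊥-elim (¬avoids (v≢A , v≢B))

hits : ℕ → ℕ → ℕ
hits A zero    = 0
hits A (suc M) = indicator (M ℕ.≟ A) + hits A M

hits-≤ : ∀ A M → M ≤ A → hits A M ≡ 0
hits-≤ A zero    _   = refl
hits-≤ A (suc M) M<A = cong₂ _+_ (indicator-no (M ℕ.≟ A) (λ M≡A → ℕₚ.<-irrefl M≡A M<A))
                                 (hits-≤ A M (ℕₚ.<⇒≤ M<A))

hits-< : ∀ A M → A < M → hits A M ≡ 1
hits-< A (suc M) A<1+M with M ℕ.≟ A
... | yes M≡A = cong₂ _+_ (indicator-yes (M ℕ.≟ A) M≡A) (hits-≤ A M (ℕₚ.≤-reflexive M≡A))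
... | no M≢A  = cong₂ _+_ (indicator-no (M ℕ.≟ A) M≢A)
                          (hits-< A M (ℕₚ.≤∧≢⇒< (ℕₚ.≤-pred A<1+M) (λ A≡M → M≢A (sym A≡M))))

avoiding+hits : ∀ {A B} → A ≢ B → ∀ M → avoiding A B M + (hits A M + hits B M) ≡ M
avoiding+hits A≢B zero    = refl
avoiding+hits {A} {B} A≢B (suc M) = begin
  (i + av) + ((ia + ha) + (ib + hb)) ≡⟨ shuffle i av ia ha ib hb ⟩
  (i + (ia + ib)) + (av + (ha + hb)) ≡⟨ cong₂ _+_ (indicator-exclusive (M ℕ.≟ A) (M ℕ.≟ B) M≢A∨M≢B)
                                                  (avoiding+hits A≢B M) ⟩
  suc M                              ∎
  where
  open ≡-Reasoning
  open +-*-Solver using (solve; _:+_; _:=_)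
  i  = indicator (avoids? A B M)
  ia = indicator (M ℕ.≟ A)
  ib = indicator (M ℕ.≟ B)
  av = avoiding A B M
  ha = hits A M
  hb = hits B M
  M≢A∨M≢B : ¬ (M ≡ A × M ≡ B)
  M≢A∨M≢B (M≡A , M≡B) = A≢B (trans (sym M≡A) M≡B)
  shuffle : ∀ i av ia ha ib hb → (i + av) + ((ia + ha) + (ib + hb)) ≡ (i + (ia + ib)) + (av + (ha + hb))
  shuffle = solve 6 (λ i av ia ha ib hb → (i :+ av) :+ ((ia :+ ha) :+ (ib :+ hb))
                                        := (i :+ (ia :+ ib)) :+ (av :+ (ha :+ hb))) refl

avoiding-all-but-two : ∀ {A B} X → A ≢ B → A < 2 + X → B < 2 + X → avoiding A B (2 + X) ≡ X
avoiding-all-but-two {A} {B} X A≢B A<2+X B<2+X = ℕₚ.+-cancelʳ-≡ 2 (avoiding A B (2 + X)) X (begin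
  avoiding A B (2 + X) + 2
    ≡⟨ cong₂ (λ a b → avoiding A B (2 + X) + (a + b)) (hits-< A _ A<2+X) (hits-< B _ B<2+X) ⟨
  avoiding A B (2 + X) + (hits A (2 + X) + hits B (2 + X))
    ≡⟨ avoiding+hits A≢B (2 + X) ⟩
  2 + X
    ≡⟨ ℕₚ.+-comm 2 X ⟩
  X + 2
    ∎)
  where open ≡-Reasoning

*-distribˡ-+₃ : ∀ k x y z → k * x + k * y + k * z ≡ k * (x + (y + z))
*-distribˡ-+₃ = solve 4 (λ k x y z → k :* x :+ k :* y :+ k :* z := k :* (x :+ (y :+ z))) refl
  where open +-*-Solver using (solve; _:+_; _:*_; _:=_)

-- Wide transpositions in blocks and pairs of blocks

module _ {N : ℕ} where

  Wide : Fin N → Fin N → Set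
  Wide a b = suc (toℕ a) < toℕ b

  record Narrow (a b : Fin N) : Set where
    constructor narrow
    field
      ¬wide  : ¬ Wide a b
      ¬wide′ : ¬ Wide b a

  Narrow-sym : ∀ {a b} → Narrow a b → Narrow b a
  Narrow-sym (narrow ¬ab ¬ba) = narrow ¬ba ¬ab

  Narrow-step : ∀ {a b} → toℕ a ≡ suc (toℕ b) → Narrow a b
  Narrow-step {a} a≡1+b =
    narrow (λ wide → ℕₚ.<-asym (ℕₚ.<-trans (ℕₚ.n<1+n (toℕ a)) wide) (ℕₚ.≤-reflexive (sym a≡1+b)))
           (λ wide → ℕₚ.<-irrefl (sym a≡1+b) wide)

  Wide⇒≢ : ∀ {a b} → Wide a b → a ≢ b
  Wide⇒≢ {a} wide refl = ℕₚ.<-irrefl refl (ℕₚ.<-trans (ℕₚ.n<1+n (toℕ a)) wide)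

  Wide⇒¬step-down : ∀ {a b hi lo} → Wide a b → toℕ hi ≡ suc (toℕ lo) → swapVal a b hi ≢ lo
  Wide⇒¬step-down {a} {b} {hi} {lo} wide hi≡1+lo eq with swapVal-case a b hi
  ... | at-left refl    = ℕₚ.<-asym (ℕₚ.<-trans (ℕₚ.n<1+n (toℕ hi)) wide)
                            (subst (λ x → toℕ x < toℕ hi) (trans (sym eq) (swapVal-left hi b))
                                   (ℕₚ.≤-reflexive (sym hi≡1+lo)))
  ... | at-right _ refl =
    ℕₚ.<-irrefl (sym (trans hi≡1+lo (cong (suc ∘ toℕ) (trans (sym eq) (swapVal-right a hi))))) wide
  ... | off hi≢a hi≢b   =
    ℕₚ.1+n≢n (trans (sym hi≡1+lo) (cong toℕ (trans (sym (swapVal-off a b hi≢a hi≢b)) eq)))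

TranspositionStep-embed-step-down : ∀ {n} {hi lo : Fin (suc n)} π → toℕ hi ≡ suc (toℕ lo) →
                                    TranspositionStep (embed hi π , embed lo π)
TranspositionStep-embed-step-down π hi≡1+lo =
  transpositionStep (λ lo≡hi → ℕₚ.1+n≢n (trans (sym hi≡1+lo) (cong toℕ (sym lo≡hi))))
                    (embed-step-down π hi≡1+lo)

Wide⇒¬embed-step-down : ∀ {n} {a b hi lo : Fin (suc n)} π π′ → Wide a b → toℕ hi ≡ suc (toℕ lo) →
                        act a b (embed hi π) ≢ embed lo π′
Wide⇒¬embed-step-down π π′ wide hi≡1+lo eq = Wide⇒¬step-down wide hi≡1+lo (act-embed-lastEntry eq)

count-block-through : ∀ {n} (L : List (Word n)) {a b v} → a ≢ b → v ≡ a ⊎ v ≡ b →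
                      count a b (map (embed v) L) ≡ 0
count-block-through L {a} {b} a≢b v∈ab =
  count-map-≡0 (embed _) a b (λ _ _ eq → swapVal-moves a≢b v∈ab (act-embed-lastEntry eq)) L

module _ {n K : ℕ} {c d : Fin n} {L} (C : BalancedCode K c d L) where

  count-block-avoiding : ∀ v → Narrow (punchIn v c) (punchIn v d) → ∀ a b → Wide a b → v ≢ a → v ≢ b →
                         count a b (map (embed v) L) ≡ K
  count-block-avoiding v cut-narrow a b wide v≢a v≢b = begin
    count a b (map (embed v) L)
      ≡⟨ cong₂ (λ x y → count x y (map (embed v) L))
               (Finₚ.punchIn-punchOut v≢a) (Finₚ.punchIn-punchOut v≢b) ⟨
    count (punchIn v a′) (punchIn v b′) (map (embed v) L)
      ≡⟨ Relabelling.count-map (embedding v) a′ b′ L ⟩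
    count a′ b′ L
      ≡⟨ BalancedCode.count-off-closing C a′ b′ a′≢b′ not-closing ⟩
    K ∎
    where
    open ≡-Reasoning
    a′ b′ : Fin n
    a′ = punchOut v≢a
    b′ = punchOut v≢b
    wide′ : Wide (punchIn v a′) (punchIn v b′)
    wide′ = subst₂ Wide (sym (Finₚ.punchIn-punchOut v≢a)) (sym (Finₚ.punchIn-punchOut v≢b)) wide
    a′≢b′ : a′ ≢ b′
    a′≢b′ a′≡b′ = Wide⇒≢ wide′ (cong (punchIn v) a′≡b′)
    not-closing : ¬ SamePair a′ b′ c d
    not-closing (inj₁ (refl , refl)) = Narrow.¬wide cut-narrow wide′
    not-closing (inj₂ (refl , refl)) = Narrow.¬wide′ cut-narrow wide′

  count-block : ∀ v → Narrow (punchIn v c) (punchIn v d) → ∀ a b → Wide a b →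
                count a b (map (embed v) L) ≡ K * indicator (avoids? (toℕ a) (toℕ b) (toℕ v))
  count-block v cut-narrow a b wide = ≡*indicator (avoids? (toℕ a) (toℕ b) (toℕ v)) K
    (λ (v≢a , v≢b) → count-block-avoiding v cut-narrow a b wide (v≢a ∘ cong toℕ) (v≢b ∘ cong toℕ))
    (λ ¬avoids → count-block-through L (Wide⇒≢ wide)
                   (Sum.map Finₚ.toℕ-injective Finₚ.toℕ-injective (¬avoids⇒hits ¬avoids)))

toℕ-suc≡suc-toℕ-inject₁ : ∀ {n} (u : Fin n) → toℕ (suc u) ≡ suc (toℕ (inject₁ u))
toℕ-suc≡suc-toℕ-inject₁ u = cong suc (sym (Finₚ.toℕ-inject₁ u))

between-adjacent : ∀ {n} (u : Fin n) v → toℕ u ≤ toℕ v → toℕ v ≤ suc (toℕ u) → v ≡ suc u ⊎ v ≡ inject₁ u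
between-adjacent u v u≤v v≤1+u with ℕₚ.m≤n⇒m<n∨m≡n v≤1+u
... | inj₂ v≡1+u     = inj₁ (Finₚ.toℕ-injective v≡1+u)
... | inj₁ (s≤s v≤u) =
  inj₂ (Finₚ.toℕ-injective (trans (ℕₚ.≤-antisym v≤u u≤v) (sym (Finₚ.toℕ-inject₁ u))))

All-lastEntry-embed : ∀ {n} v (L : List (Word n)) → All (λ w → lastEntry w ≡ v) (map (embed v) L)
All-lastEntry-embed v L = Allₚ.map⁺ (All.universal (lastEntry-embed v) L)

blockPair : ∀ {n} → Fin n → List (Word n) → List (Word (suc n))
blockPair u L = map (embed (suc u)) L ++ map (embed (inject₁ u)) (reverse L)

module _ {n K : ℕ} {c d : Fin n} {L} (C : BalancedCode K c d L) (u : Fin n) where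

  private
    upper : IsGrayPath (map (embed (suc u)) L) (embed (suc u) idW) (embed (suc u) (act c d idW))
    upper = Relabelling.IsGrayPath-map (embedding (suc u)) (BalancedCode.path C)
    lower : IsGrayPath (map (embed (inject₁ u)) (reverse L)) (embed (inject₁ u) (act c d idW)) (embed (inject₁ u) idW)
    lower = Relabelling.IsGrayPath-map (embedding (inject₁ u)) (IsGrayPath-reverse (BalancedCode.path C))

  blockPair-path : IsGrayPath (blockPair u L) (embed (suc u) idW) (embed (inject₁ u) idW)
  blockPair-path = IsGrayPath-++ upper lower
    (TranspositionStep-embed-step-down (act c d idW) (toℕ-suc≡suc-toℕ-inject₁ u))
    (disjoint-by (All-lastEntry-embed (suc u) L) (All-lastEntry-embed (inject₁ u) (reverse L))
      λ ≡suc ≡inject₁ → ℕₚ.1+n≢n (trans (sym (toℕ-suc≡suc-toℕ-inject₁ u))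
                                        (cong toℕ (trans (sym ≡suc) ≡inject₁))))

  blockPair-lastEntries : All (λ w → toℕ u ≤ toℕ (lastEntry w) × toℕ (lastEntry w) ≤ suc (toℕ u))
                              (blockPair u L)
  blockPair-lastEntries = Allₚ.++⁺
    (All.map (λ ≡suc → subst Between (sym (cong toℕ ≡suc)) (ℕₚ.n≤1+n _ , ℕₚ.≤-refl))
             (All-lastEntry-embed (suc u) L))
    (All.map (λ ≡inject₁ → subst Between (sym (trans (cong toℕ ≡inject₁) (Finₚ.toℕ-inject₁ u)))
                                 (ℕₚ.≤-refl , ℕₚ.n≤1+n _))
             (All-lastEntry-embed (inject₁ u) (reverse L)))
    where
    Between : ℕ → Set
    Between x = toℕ u ≤ x × x ≤ suc (toℕ u)

  blockPair-complete : ∀ v π → IsPerm π → toℕ u ≤ toℕ v → toℕ v ≤ suc (toℕ u) → embed v π ∈ blockPair u L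
  blockPair-complete v π π-perm u≤v v≤1+u with between-adjacent u v u≤v v≤1+u
  ... | inj₁ refl = ∈ₚ.∈-++⁺ˡ (∈ₚ.∈-map⁺ (embed v) (BalancedCode.complete C π π-perm))
  ... | inj₂ refl = ∈ₚ.∈-++⁺ʳ (map (embed (suc u)) L)
                              (∈ₚ.∈-map⁺ (embed v) (∈-reverse (BalancedCode.complete C π π-perm)))

  blockPair-count : Narrow (punchIn (suc u) c) (punchIn (suc u) d) →
                    Narrow (punchIn (inject₁ u) c) (punchIn (inject₁ u) d) →
                    ∀ a b → Wide a b → count a b (blockPair u L) ≡
                      K * indicator (avoids? (toℕ a) (toℕ b) (suc (toℕ u))) +
                      K * indicator (avoids? (toℕ a) (toℕ b) (toℕ u))
  blockPair-count narrow-upper narrow-lower a b wide = begin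
    count a b (blockPair u L)
      ≡⟨ count-++ a b (IsGrayPath.ends upper) (IsGrayPath.starts lower)
                  (Wide⇒¬embed-step-down _ _ wide (toℕ-suc≡suc-toℕ-inject₁ u)) ⟩
    count a b (map (embed hi) L) + count a b (map (embed lo) (reverse L))
      ≡⟨ cong (count a b (map (embed hi) L) +_) (begin
           count a b (map (embed lo) (reverse L)) ≡⟨ cong (count a b) (Listₚ.reverse-map (embed lo) L) ⟩
           count a b (reverse (map (embed lo) L)) ≡⟨ count-reverse a b (map (embed lo) L) ⟩
           count a b (map (embed lo) L)           ∎) ⟩
    count a b (map (embed hi) L) + count a b (map (embed lo) L)
      ≡⟨ cong₂ _+_ (count-block C hi narrow-upper a b wide) (count-block C lo narrow-lower a b wide) ⟩
    share (suc (toℕ u)) + share (toℕ lo)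
      ≡⟨ cong (λ x → share (suc (toℕ u)) + share x) (Finₚ.toℕ-inject₁ u) ⟩
    share (suc (toℕ u)) + share (toℕ u)
      ∎
    where
    open ≡-Reasoning
    hi lo : Fin (suc n)
    hi = suc u
    lo = inject₁ u
    share : ℕ → ℕ
    share x = K * indicator (avoids? (toℕ a) (toℕ b) x)

-- The extension

double : ℕ → ℕ
double zero    = zero
double (suc j) = suc (suc (double j))

double-suc-< : ∀ {j n} → double (suc j) < n → double j < n
double-suc-< {j} j< = ℕₚ.<-trans (ℕₚ.n<1+n (double j)) (ℕₚ.<-trans (ℕₚ.n<1+n (suc (double j))) j<)

odd⇒≡1+double : ∀ m → suc (suc m) % 2 ≡ 1 → ∃[ i ] (m ≡ suc (double i))
odd⇒≡1+double (suc zero)    _   = zero , refl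
odd⇒≡1+double (suc (suc m)) odd = let i , m≡1+2i = odd⇒≡1+double m odd in
                                  suc i , cong (λ x → suc (suc x)) m≡1+2i

module Extension {i K : ℕ} {GA GB : List (Word (3 + double i))}
                 (codeA : BalancedCode K zero (suc zero) GA)
                 (codeB : BalancedCode K (suc (suc zero)) (suc zero) GB) where

  blockPairs : ∀ j → .(double j < 3 + double i) → List (Word (4 + double i))
  blockPairs zero    j< = blockPair (fromℕ< j<) GB
  blockPairs (suc j) j< = blockPair (fromℕ< j<) GA ++ blockPairs j (double-suc-< j<)

  Narrow-01 : ∀ (v : Fin (4 + double i)) → 2 ≤ toℕ v → Narrow (punchIn v zero) (punchIn v (suc zero))
  Narrow-01 (suc (suc v)) _        = Narrow-sym (Narrow-step refl)
  Narrow-01 (suc zero)    (s≤s ())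

  junction-adjacent : ∀ j .(j< : double (suc j) < 3 + double i) →
                      toℕ (inject₁ (fromℕ< j<)) ≡ suc (toℕ (suc (fromℕ< (double-suc-< j<))))
  junction-adjacent j j< = begin
    toℕ (inject₁ (fromℕ< j<))                  ≡⟨ Finₚ.toℕ-inject₁ (fromℕ< j<) ⟩
    toℕ (fromℕ< j<)                            ≡⟨ Finₚ.toℕ-fromℕ< j< ⟩
    suc (suc (double j))                       ≡⟨ cong (λ x → suc (suc x)) (Finₚ.toℕ-fromℕ< (double-suc-< j<)) ⟨
    suc (suc (toℕ (fromℕ< (double-suc-< j<)))) ∎
    where open ≡-Reasoning

  blockPairs-lastEntries : ∀ j .(j< : double j < 3 + double i) →
                           All (λ w → toℕ (lastEntry w) ≤ suc (double j)) (blockPairs j j<)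
  blockPairs-lastEntries zero    j< = All.map proj₂ (blockPair-lastEntries codeB zero)
  blockPairs-lastEntries (suc j) j< = Allₚ.++⁺
    (All.map (λ {w} (_ , ≤1+u) → subst (λ x → toℕ (lastEntry w) ≤ suc x) (Finₚ.toℕ-fromℕ< j<) ≤1+u)
             (blockPair-lastEntries codeA (fromℕ< j<)))
    (All.map (λ ≤1+2j → ℕₚ.m≤n⇒m≤1+n (ℕₚ.m≤n⇒m≤1+n ≤1+2j))
             (blockPairs-lastEntries j (double-suc-< j<)))

  blockPairs-path : ∀ j .(j< : double j < 3 + double i) →
                    IsGrayPath (blockPairs j j<) (embed (suc (fromℕ< j<)) idW) (embed zero idW)
  blockPairs-path zero    j< = blockPair-path codeB zero
  blockPairs-path (suc j) j< = IsGrayPath-++ (blockPair-path codeA (fromℕ< j<)) (blockPairs-path j (double-suc-< j<))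
    (TranspositionStep-embed-step-down idW (junction-adjacent j j<))
    (disjoint-by (blockPair-lastEntries codeA (fromℕ< j<)) (blockPairs-lastEntries j (double-suc-< j<))
      λ {w} (u≤ , _) ≤1+2j → ℕₚ.<-irrefl refl
        (ℕₚ.≤-trans (subst (_≤ toℕ (lastEntry w)) (Finₚ.toℕ-fromℕ< j<) u≤) ≤1+2j))

  blockPairs-complete : ∀ j .(j< : double j < 3 + double i) v π → IsPerm π → toℕ v ≤ suc (double j) →
                        embed v π ∈ blockPairs j j<
  blockPairs-complete zero    j< v π π-perm v≤1 = blockPair-complete codeB zero v π π-perm z≤n v≤1
  blockPairs-complete (suc j) j< v π π-perm v≤3+2j with toℕ v ℕ.≤? suc (double j)
  ... | yes v≤1+2j = ∈ₚ.∈-++⁺ʳ (blockPair (fromℕ< j<) GA)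
                               (blockPairs-complete j (double-suc-< j<) v π π-perm v≤1+2j)
  ... | no v≰1+2j  = ∈ₚ.∈-++⁺ˡ (blockPair-complete codeA (fromℕ< j<) v π π-perm
                       (subst (_≤ toℕ v) (sym (Finₚ.toℕ-fromℕ< j<)) (ℕₚ.≰⇒> v≰1+2j))
                       (subst (λ x → toℕ v ≤ suc x) (sym (Finₚ.toℕ-fromℕ< j<)) v≤3+2j))

  blockPairs-count : ∀ j .(j< : double j < 3 + double i) a b → Wide a b →
                     count a b (blockPairs j j<) ≡ K * avoiding (toℕ a) (toℕ b) (2 + double j)
  blockPairs-count zero j< a b wide = begin
    count a b (blockPair zero GB)
      ≡⟨ blockPair-count codeB zero (Narrow-step refl) (Narrow-step refl) a b wide ⟩
    K * indicator (avoids? A B 1) + K * indicator (avoids? A B 0)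
      ≡⟨ cong (λ x → K * indicator (avoids? A B 1) + K * x) (ℕₚ.+-identityʳ _) ⟨
    K * indicator (avoids? A B 1) + K * avoiding A B 1
      ≡⟨ ℕₚ.*-distribˡ-+ K (indicator (avoids? A B 1)) (avoiding A B 1) ⟨
    K * avoiding A B 2
      ∎
    where
    open ≡-Reasoning
    A B : ℕ
    A = toℕ a
    B = toℕ b
  blockPairs-count (suc j) j< a b wide = begin
    count a b (blockPair u GA ++ blockPairs j (double-suc-< j<))
      ≡⟨ count-++ a b (IsGrayPath.ends (blockPair-path codeA u))
                      (IsGrayPath.starts (blockPairs-path j (double-suc-< j<)))
                      (Wide⇒¬embed-step-down idW idW wide (junction-adjacent j j<)) ⟩
    count a b (blockPair u GA) + count a b (blockPairs j (double-suc-< j<))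
      ≡⟨ cong₂ _+_ (blockPair-count codeA u (Narrow-01 (suc u) 2≤1+u) (Narrow-01 (inject₁ u) 2≤u′) a b wide)
                   (blockPairs-count j (double-suc-< j<) a b wide) ⟩
    K * indicator (avoids? A B (suc (toℕ u))) + K * indicator (avoids? A B (toℕ u)) + K * avoiding A B M
      ≡⟨ cong (λ x → K * indicator (avoids? A B (suc x)) + K * indicator (avoids? A B x) + K * avoiding A B M)
              (Finₚ.toℕ-fromℕ< j<) ⟩
    K * indicator (avoids? A B (suc M)) + K * indicator (avoids? A B M) + K * avoiding A B M
      ≡⟨ *-distribˡ-+₃ K (indicator (avoids? A B (suc M))) (indicator (avoids? A B M)) (avoiding A B M) ⟩
    K * avoiding A B (2 + M)
      ∎
    where
    open ≡-Reasoning
    A B : ℕ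
    A = toℕ a
    B = toℕ b
    M : ℕ
    M = 2 + double j
    u : Fin (3 + double i)
    u = fromℕ< j<
    2≤u : 2 ≤ toℕ u
    2≤u = subst (2 ≤_) (sym (Finₚ.toℕ-fromℕ< j<)) (s≤s (s≤s z≤n))
    2≤1+u : 2 ≤ toℕ (suc u)
    2≤1+u = ℕₚ.m≤n⇒m≤1+n 2≤u
    2≤u′ : 2 ≤ toℕ (inject₁ u)
    2≤u′ = subst (2 ≤_) (sym (Finₚ.toℕ-inject₁ u)) 2≤u

  top< : double (suc i) < 3 + double i
  top< = ℕₚ.n<1+n (double (suc i))

  extension : List (Word (4 + double i))
  extension = blockPairs (suc i) top<

  private
    extension-path : IsGrayPath extension (embed (suc (fromℕ< top<)) idW) (embed zero idW)
    extension-path = blockPairs-path (suc i) top<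

  extension-IsGrayCode : IsGrayCode (4 + double i) extension
  extension-IsGrayCode = perms , unique , complete , moves
    where
    open IsGrayPath extension-path
    complete : ∀ w → IsPerm w → w ∈ extension
    complete w w-perm = let π , π-perm , embed≡w = embed-complete w w-perm in
      subst (_∈ extension) embed≡w
        (blockPairs-complete (suc i) top< (lastEntry w) π π-perm (ℕₚ.≤-pred (Finₚ.toℕ<n (lastEntry w))))

  extension-count : ∀ a b → Wide a b → count a b extension ≡ K * (2 + double i)
  extension-count a b wide = trans (blockPairs-count (suc i) top< a b wide)
    (cong (K *_) (avoiding-all-but-two (2 + double i) (Wide⇒≢ wide ∘ Finₚ.toℕ-injective)
                                       (Finₚ.toℕ<n a) (Finₚ.toℕ<n b)))

  extension-starts : StartsAt extension idW
  extension-starts = subst (StartsAt extension) top-idW (IsGrayPath.starts extension-path)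
    where
    top-idW : embed (suc (fromℕ< top<)) idW ≡ idW
    top-idW = trans (cong (λ v → embed v idW)
                          (Finₚ.toℕ-injective (trans (cong suc (Finₚ.toℕ-fromℕ< top<)) (sym (Finₚ.toℕ-fromℕ _)))))
                    embed-fromℕ-idW

  extension-ends : EndsAt extension rotW
  extension-ends = subst (EndsAt extension) embed-zero-idW (IsGrayPath.ends extension-path)

codes-closed-by-01-and-21 : ∀ {i K G} → BalancedCode K (penult {suc (double i)}) ult G →
                            ∃[ GA ] ∃[ GB ] (BalancedCode K zero (suc zero) GA ×
                                             BalancedCode K (suc (suc zero)) (suc zero) GB)
codes-closed-by-01-and-21 {i} {K} {G} code = _ , _ , codeA , codeB
  where
  open Conjugation using (conj)
  code′ : BalancedCode K zero ult (map (conj penult zero) G)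
  code′ = conjugate-code penult zero code (swapVal-left penult zero)
            (swapVal-off penult zero (Finₚ.fromℕ≢inject₁ {i = fromℕ (suc (double i))}) (λ ()))
  GA : List (Word (3 + double i))
  GA = map (conj ult (suc zero)) (map (conj penult zero) G)
  codeA : BalancedCode K zero (suc zero) GA
  codeA = conjugate-code ult (suc zero) code′
            (swapVal-off ult (suc zero) (λ ()) (λ ())) (swapVal-left ult (suc zero))
  codeB : BalancedCode K (suc (suc zero)) (suc zero) (map (conj zero (suc (suc zero))) GA)
  codeB = conjugate-code zero (suc (suc zero)) codeA
            (swapVal-left zero (suc (suc zero))) (swapVal-off zero (suc (suc zero)) (λ ()) (λ ()))

2*m!*[1+m]≡2*[1+m]! : ∀ m → 2 * (m !) * suc m ≡ 2 * (suc m !)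
2*m!*[1+m]≡2*[1+m]! m = trans (ℕₚ.*-assoc 2 (m !) (suc m)) (cong (2 *_) (ℕₚ.*-comm (m !) (suc m)))

proposition4p5 : (m : ℕ) → suc (suc m) % 2 ≡ 1 →
    (G : List (Word (suc (suc m)))) →
    IsGrayCode (suc (suc m)) G →
    ClosedBy penult ult G →
    Balanced (suc (suc m)) G →
    StartsAt G idW →
    EndsAt G (act penult ult idW) →
    ∃[ H ] (IsGrayCode (suc (suc (suc m))) H × AlmostBalanced (suc (suc (suc m))) H ×
            StartsAt H idW × EndsAt H rotW)
-- The closing transposition is already determined by the two endpoints.
proposition4p5 m odd G gray _ balanced starts ends with odd⇒≡1+double m odd
... | i , refl with codes-closed-by-01-and-21 (balancedCode gray balanced starts ends)
...   | _ , _ , codeA , codeB = extension , extension-IsGrayCode , almost-balanced , extension-starts , extension-ends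
  where
  open Extension codeA codeB
  almost-balanced : AlmostBalanced (suc (suc (suc m))) extension
  almost-balanced a b wide = trans (extension-count a b wide) (2*m!*[1+m]≡2*[1+m]! m)
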